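{- Let $k\geq 2$ be an integer and let $\mathrm{And}_k$ be the graph with vertex set $\{v_0,v_1,\dotsc,v_{3k-2}\}$ in which $v_i$ and $v_j$ are adjacent if and only if $|i-j|\equiv 1 \pmod 3$. Define $F_k := U_k^{(1)}\cup U_k^{(2)}$, where \[ U_k^{(1)} := \bigcup_{i=0}^{\lfloor k/2\rfloor-1}\ \bigcup_{j=i}^{\lfloor k/2\rfloor-1} \bigl\{ \{ v_{(3k-4)-3i},\, v_{(3k-5)-3j} \}\bigr\},\qquad U_k^{(2)} := \bigcup_{i=0}^{\lfloor (k-1)/2\rfloor-1}\ \bigcup_{j=0}^{\lfloor (k-1)/2\rfloor-1-i} \bigl\{ \{ v_{3i},\, v_{(3i+1)+3j} \}\bigr\}. \] Then: (1) $F_k$ is a minimal bipartification of $\mathrm{And}_k$ in the stronger sense that for every edge $e\in F_k$, the graph $(V(\mathrm{And}_k), E(\mathrm{And}_k)\setminus (F_k\setminus\{e\}))$ contains a $5$-cycle (and in particular $(V(\mathrm{And}_k),E(\mathrm{And}_k)\setminus F_k)$ is bipartite while removing any single edge from $F_k$ destroys this property); (2) the bipartite graph $\mathrm{And}_k - F_k$ admits the bipartition $A_k\cup B_k$ (i.e. $A_k, B_k$ partition the vertex set and every edge of $\mathrm{And}_k-F_k$ has one endpoint in $A_k$ and one in $B_k$), where \[ A_k := \{ v_{3i}:\ i=0,\dotsc,k-1\}\cup\{ v_{3i+1}:\ i=0,\dotsc,\lfloor (k-1)/2\rfloor-1\}, \] \[ B_k := \{ v_{3i+2}:\ i=0,\dotsc,k-2\}\cup\{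 v_{3i+1}:\ i=\lfloor (k-1)/2\rfloor,\dotsc,k-1\}; \] (3) $|F_k| = \lfloor k^2/4\rfloor = \bigl\lfloor \tfrac{1}{36}\bigl(|\mathrm{And}_k|+1\bigr)^2\bigr\rfloor$, where $|\mathrm{And}_k|$ denotes the number of vertices of $\mathrm{And}_k$.
   Context: For a graph $G$, a minimal bipartification of $G$ is a set of edges $F\subseteq E(G)$ such that the graph $(V(G),E(G)\setminus F)$ is bipartite and for every $e\in F$ the graph $(V(G),E(G)\setminus(F\setminus\{e\}))$ is not bipartite. For a graph $G$, $|G|$ denotes its number of vertices, and $G-F$ denotes the graph $(V(G),E(G)\setminus F)$. -}

module Defs where

open import Data.Nat using (ℕ; zero; suc; _+_; _*_; _∸_; _<_; _≤_; _/_; _%_)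
open import Data.Bool using (Bool)
open import Data.List using (List; []; _∷_; map; concatMap; upTo; length)
open import Data.List.Membership.Propositional using (_∈_)
open import Data.List.Relation.Unary.AllPairs using (AllPairs)
open import Data.Product using (Σ; _×_; _,_; proj₁; proj₂; ∃; ∃-syntax)
open import Data.Sum using (_⊎_)
open import Relation.Nullary using (¬_)
open import Relation.Binary.PropositionalEquality using (_≡_; _≢_)

-- Simple graphs on the vertex set {0, …, n-1} (vertex v_i is the number i).
-- Edges are unordered; an edge set / adjacency is a relation on ℕ that is
-- read symmetrically.

record Graph : Set₁ where
  field
    order : ℕ
    Adj   : ℕ → ℕ → Set

open Graph public

EdgeSet : Set₁
EdgeSet = ℕ → ℕ → Set

IsEdge : Graph → ℕ → ℕ → Set
IsEdge G u v = u < order G × v < order G × Adj G u v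

_─_ : Graph → EdgeSet → Graph
G ─ F = record { order = order G ; Adj = λ u v → Adj G u v × ¬ F u v }

Bipartite : Graph → Set
Bipartite G = Σ (ℕ → Bool) λ c → (∀ u v → IsEdge G u v → c u ≢ c v)

SameEdge : ℕ × ℕ → ℕ × ℕ → Set
SameEdge (u , v) (a , b) = (u ≡ a × v ≡ b) ⊎ (u ≡ b × v ≡ a)

_∖₁_ : EdgeSet → ℕ × ℕ → EdgeSet
(F ∖₁ e) u v = F u v × ¬ SameEdge (u , v) e

_⊆E_ : EdgeSet → Graph → Set
F ⊆E G = ∀ u v → F u v → IsEdge G u v

MinimalBipartification : Graph → EdgeSet → Set
MinimalBipartification G F =
  F ⊆E G × Bipartite (G ─ F) ×
  (∀ a b → F a b → ¬ Bipartite (G ─ (F ∖₁ (a , b))))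

HasC5 : Graph → Set
HasC5 G = ∃[ x0 ] ∃[ x1 ] ∃[ x2 ] ∃[ x3 ] ∃[ x4 ]
  (AllPairs _≢_ (x0 ∷ x1 ∷ x2 ∷ x3 ∷ x4 ∷ []) ×
   IsEdge G x0 x1 × IsEdge G x1 x2 × IsEdge G x2 x3 ×
   IsEdge G x3 x4 × IsEdge G x4 x0)

dist : ℕ → ℕ → ℕ
dist i j = (i ∸ j) + (j ∸ i)

-- vertices v_0, …, v_{3k-2}: 3k-1 vertices
And : ℕ → Graph
And k = record { order = 3 * k ∸ 1 ; Adj = λ i j → dist i j % 3 ≡ 1 }

U1 : ℕ → List (ℕ × ℕ)
U1 k = concatMap (λ i → map (λ j → ((3 * k ∸ 4) ∸ 3 * i , (3 * k ∸ 5) ∸ 3 * j))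
                            (map (i +_) (upTo (m ∸ i))))
                 (upTo m)
  where m = k / 2

U2 : ℕ → List (ℕ × ℕ)
U2 k = concatMap (λ i → map (λ j → (3 * i , (3 * i + 1) + 3 * j)) (upTo (m ∸ i)))
                 (upTo m)
  where m = (k ∸ 1) / 2

Flist : ℕ → List (ℕ × ℕ)
Flist k = U1 k Data.List.++ U2 k

F : ℕ → EdgeSet
F k u v = ((u , v) ∈ Flist k) ⊎ ((v , u) ∈ Flist k)

A : ℕ → ℕ → Set
A k v = (∃[ i ] (i < k × v ≡ 3 * i)) ⊎ (∃[ i ] (i < (k ∸ 1) / 2 × v ≡ 3 * i + 1))

B : ℕ → ℕ → Set
B k v = (∃[ i ] (i ≤ k ∸ 2 × v ≡ 3 * i + 2)) ⊎
        (∃[ i ] ((k ∸ 1) / 2 ≤ i × i ≤ k ∸ 1 × v ≡ 3 * i + 1))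

module Submission where

-- Write the vertices as v_{3q+r}.  Vertices are adjacent iff their indices
-- differ by 1 mod 3, so all edges join residue classes 0–1, 1–2 or 2–0, and
-- which pairs are adjacent is decided by comparing quotients.  The heart of
-- the proof is an explicit description of F_k: U_k^(2) is the set of edges of
-- And_k with both ends in A_k, and U_k^(1) the set of edges with both ends in
-- B_k.  Hence And_k - F_k has exactly the A_k–B_k edges, which gives (2) and
-- bipartiteness; putting one F_k-edge back closes an explicit 5-cycle whose
-- other four edges cross between A_k and B_k, which gives (1).  For (3), both
-- U-lists are "triangle lists" of an injective function, so they contain no
-- repetition and have T(⌊k/2⌋) and T(⌊(k-1)/2⌋) elements (T triangular).

open import Defs
open import Data.Nat using (ℕ; zero; suc; _+_; _*_; _∸_; _/_; _%_; _<_; _≤_; _<?_; _≤?_; z≤n; s≤s; s≤s⁻¹; NonZero)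
open import Data.Nat.Properties
open import Data.Nat.DivMod using ([m+kn]%n≡m%n; m<n⇒m%n≡m; +-distrib-/; m<n⇒m/n≡0; m*n/n≡m; m*n%n≡0; m*n/o*n≡m/o; m/n<m)
open import Data.Nat.Tactic.RingSolver using (solve-∀)
open import Data.Bool using (Bool; true; false; not)
open import Data.Bool.Properties using (¬-not; not-involutive)
open import Data.Empty using (⊥-elim)
open import Data.Product using (∃; _×_; _,_; proj₁; proj₂)
open import Data.Sum using (_⊎_; inj₁; inj₂)
import Data.Sum as Sum
open import Data.List using (List; []; _∷_; map; concat; concatMap; applyUpTo; upTo; length)
open import Data.List.Properties using (length-++; length-map; length-applyUpTo; map-∘; map-cong)
open import Data.List.Membership.Propositional using (_∈_)
open import Data.List.Membership.Propositional.Properties using (∈-map⁺; ∈-map⁻; ∈-concat⁺′; ∈-concat⁻′; ∈-upTo⁺; ∈-upTo⁻; ∈-++⁺ˡ; ∈-++⁺ʳ; ∈-++⁻)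
open import Data.List.Relation.Unary.All as All using (All; []; _∷_)
import Data.List.Relation.Unary.All.Properties as AllProps
open import Data.List.Relation.Unary.AllPairs using (AllPairs; []; _∷_)
import Data.List.Relation.Unary.AllPairs.Properties as AllPairs
open import Function using (id)
open import Relation.Nullary using (¬_; yes; no)
open import Relation.Binary.PropositionalEquality

[r+qn]%n≡r : ∀ q r n .{{_ : NonZero n}} → r < n → (r + q * n) % n ≡ r
[r+qn]%n≡r q r n r<n = trans ([m+kn]%n≡m%n r q n) (m<n⇒m%n≡m r<n)

[r+qn]/n≡q : ∀ q r n .{{_ : NonZero n}} → r < n → (r + q * n) / n ≡ q
[r+qn]/n≡q q r n r<n = begin
  (r + q * n) / n        ≡⟨ +-distrib-/ r (q * n) remainders<n ⟩
  r / n + q * n / n      ≡⟨ cong₂ _+_ (m<n⇒m/n≡0 r<n) (m*n/n≡m q n) ⟩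
  q                      ∎
  where
  open ≡-Reasoning
  remainders<n : r % n + (q * n) % n < n
  remainders<n = subst (_< n)
    (sym (trans (cong₂ _+_ (m<n⇒m%n≡m r<n) (m*n%n≡0 q n)) (+-identityʳ r))) r<n

0<2 : 0 < 2
0<2 = s≤s z≤n

1<2 : 1 < 2
1<2 = s≤s (s≤s z≤n)

0<3 : 0 < 3
0<3 = s≤s z≤n

1<3 : 1 < 3
1<3 = s≤s (s≤s z≤n)

2<3 : 2 < 3
2<3 = s≤s (s≤s (s≤s z≤n))

3a≡3a+0 : ∀ a → 3 * a ≡ 3 * a + 0
3a≡3a+0 a = sym (+-identityʳ (3 * a))

-- 3a + r in the shape r + q·n used by the library's division lemmas.
3a+r≡r+a*3 : ∀ a r → 3 * a + r ≡ r + a * 3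
3a+r≡r+a*3 = solve-∀

3a+r-injective : ∀ {a b r s} → r < 3 → s < 3 → 3 * a + r ≡ 3 * b + s → a ≡ b × r ≡ s
3a+r-injective {a} {b} {r} {s} r<3 s<3 eq =
  (begin
    a                     ≡⟨ sym ([r+qn]/n≡q a r 3 r<3) ⟩
    (r + a * 3) / 3       ≡⟨ cong (_/ 3) eq′ ⟩
    (s + b * 3) / 3       ≡⟨ [r+qn]/n≡q b s 3 s<3 ⟩
    b                     ∎) ,
  (begin
    r                     ≡⟨ sym ([r+qn]%n≡r a r 3 r<3) ⟩
    (r + a * 3) % 3       ≡⟨ cong (_% 3) eq′ ⟩
    (s + b * 3) % 3       ≡⟨ [r+qn]%n≡r b s 3 s<3 ⟩
    s                     ∎)
  where
  open ≡-Reasoning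
  eq′ : r + a * 3 ≡ s + b * 3
  eq′ = trans (sym (3a+r≡r+a*3 a r)) (trans eq (3a+r≡r+a*3 b s))

≢-mod3 : ∀ {x y} a b {r s} → r < 3 → s < 3 → x ≡ 3 * a + r → y ≡ 3 * b + s →
         r ≢ s ⊎ a ≢ b → x ≢ y
≢-mod3 a b r<3 s<3 refl refl (inj₁ r≢s) eq = r≢s (proj₂ (3a+r-injective {a} {b} r<3 s<3 eq))
≢-mod3 a b r<3 s<3 refl refl (inj₂ a≢b) eq = a≢b (proj₁ (3a+r-injective {a} {b} r<3 s<3 eq))

data Mod3View : ℕ → Set where
  ≡0 : ∀ q → Mod3View (3 * q)
  ≡1 : ∀ q → Mod3View (3 * q + 1)
  ≡2 : ∀ q → Mod3View (3 * q + 2)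

mod3-view : ∀ v → Mod3View v
mod3-view zero = ≡0 0
mod3-view (suc v) with mod3-view v
... | ≡0 q = subst Mod3View (+-comm (3 * q) 1) (≡1 q)
... | ≡1 q = subst Mod3View (+-suc (3 * q) 1) (≡2 q)
... | ≡2 q = subst Mod3View (3[1+q]≡1+[3q+2] q) (≡0 (suc q))
  where
  3[1+q]≡1+[3q+2] : ∀ q → 3 * suc q ≡ suc (3 * q + 2)
  3[1+q]≡1+[3q+2] = solve-∀

infix 4 _~_
_~_ : ℕ → ℕ → Set
i ~ j = dist i j % 3 ≡ 1

~-sym : ∀ i j → i ~ j → j ~ i
~-sym i j = subst (λ d → d % 3 ≡ 1) (+-comm (i ∸ j) (j ∸ i))

dist-+ : ∀ x d → dist x (x + d) ≡ d
dist-+ x d = cong₂ _+_ (m≤n⇒m∸n≡0 (m≤m+n x d)) (m+n∸m≡n x d)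

~-up : ∀ x c → x ~ (x + (3 * c + 1))
~-up x c = trans (cong (_% 3) (dist-+ x _)) (trans (cong (_% 3) (3a+r≡r+a*3 c 1)) ([r+qn]%n≡r c 1 3 1<3))

≁-up : ∀ x c r → r < 3 → r ≢ 1 → ¬ x ~ (x + (3 * c + r))
≁-up x c r r<3 r≢1 adj = r≢1 (begin
  r                                ≡⟨ sym ([r+qn]%n≡r c r 3 r<3) ⟩
  (r + c * 3) % 3                  ≡⟨ cong (_% 3) (sym (3a+r≡r+a*3 c r)) ⟩
  (3 * c + r) % 3                  ≡⟨ cong (_% 3) (sym (dist-+ x _)) ⟩
  dist x (x + (3 * c + r)) % 3     ≡⟨ adj ⟩
  1                                ∎)
  where open ≡-Reasoning

~-0-1 : ∀ {a b} → a ≤ b → 3 * a ~ 3 * b + 1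
~-0-1 {a} a≤b with m≤n⇒∃[o]m+o≡n a≤b
... | c , refl = subst (3 * a ~_) (eq a c) (~-up (3 * a) c)
  where
  eq : ∀ a c → 3 * a + (3 * c + 1) ≡ 3 * (a + c) + 1
  eq = solve-∀

~-2-1 : ∀ {a b} → b ≤ a → 3 * a + 2 ~ 3 * b + 1
~-2-1 {b = b} b≤a with m≤n⇒∃[o]m+o≡n b≤a
... | c , refl = ~-sym (3 * b + 1) (3 * (b + c) + 2) (subst (3 * b + 1 ~_) (eq b c) (~-up (3 * b + 1) c))
  where
  eq : ∀ b c → 3 * b + 1 + (3 * c + 1) ≡ 3 * (b + c) + 2
  eq = solve-∀

~-0-2 : ∀ {a b} → b < a → 3 * a ~ 3 * b + 2
~-0-2 {b = b} b<a with m≤n⇒∃[o]m+o≡n b<a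
... | c , refl = ~-sym (3 * b + 2) (3 * (suc b + c)) (subst (3 * b + 2 ~_) (eq b c) (~-up (3 * b + 2) c))
  where
  eq : ∀ b c → 3 * b + 2 + (3 * c + 1) ≡ 3 * (suc b + c)
  eq = solve-∀

≁-0-1 : ∀ {a b} → b < a → ¬ 3 * a ~ 3 * b + 1
≁-0-1 {b = b} b<a adj with m≤n⇒∃[o]m+o≡n b<a
... | c , refl = ≁-up (3 * b + 1) c 2 2<3 (λ ()) (subst (3 * b + 1 ~_) (eq b c) (~-sym (3 * (suc b + c)) (3 * b + 1) adj))
  where
  eq : ∀ b c → 3 * (suc b + c) ≡ 3 * b + 1 + (3 * c + 2)
  eq = solve-∀

≁-2-1 : ∀ {a b} → a < b → ¬ 3 * a + 2 ~ 3 * b + 1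
≁-2-1 {a = a} a<b adj with m≤n⇒∃[o]m+o≡n a<b
... | c , refl = ≁-up (3 * a + 2) c 2 2<3 (λ ()) (subst (3 * a + 2 ~_) (eq a c) adj)
  where
  eq : ∀ a c → 3 * (suc a + c) + 1 ≡ 3 * a + 2 + (3 * c + 2)
  eq = solve-∀

≁-same : ∀ a b r → ¬ 3 * a + r ~ 3 * b + r
≁-same a b r adj with ≤-total a b
... | inj₁ a≤b with m≤n⇒∃[o]m+o≡n a≤b
...   | c , refl = ≁-up (3 * a + r) c 0 0<3 (λ ()) (subst (3 * a + r ~_) (eq a c r) adj)
  where
  eq : ∀ a c r → 3 * (a + c) + r ≡ 3 * a + r + (3 * c + 0)
  eq = solve-∀
≁-same a b r adj | inj₂ b≤a with m≤n⇒∃[o]m+o≡n b≤a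
...   | c , refl = ≁-up (3 * b + r) c 0 0<3 (λ ()) (subst (3 * b + r ~_) (eq b c r) (~-sym (3 * (b + c) + r) (3 * b + r) adj))
  where
  eq : ∀ b c r → 3 * (b + c) + r ≡ 3 * b + r + (3 * c + 0)
  eq = solve-∀

≁-0-0 : ∀ a b → ¬ 3 * a ~ 3 * b
≁-0-0 a b adj = ≁-same a b 0 (subst₂ _~_ (3a≡3a+0 a) (3a≡3a+0 b) adj)

-- A graph containing a 5-cycle is not bipartite: a proper 2-colouring
-- gives x₀, x₂, x₄ the same colour, but x₄x₀ is an edge.
C5⇒¬bipartite : ∀ G → HasC5 G → ¬ Bipartite G
C5⇒¬bipartite G (x₀ , x₁ , x₂ , x₃ , x₄ , _ , e₀₁ , e₁₂ , e₂₃ , e₃₄ , e₄₀) (colour , proper) =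
  proper x₄ x₀ e₄₀ (sym (trans (two-steps e₀₁ e₁₂) (two-steps e₂₃ e₃₄)))
  where
  two-steps : ∀ {x y z} → IsEdge G x y → IsEdge G y z → colour x ≡ colour z
  two-steps {x} {y} {z} e₁ e₂ = begin
    colour x               ≡⟨ ¬-not (proper x y e₁) ⟩
    not (colour y)         ≡⟨ cong not (¬-not (proper y z e₂)) ⟩
    not (not (colour z))   ≡⟨ not-involutive (colour z) ⟩
    colour z               ∎
    where open ≡-Reasoning

bipartite-by-classes : ∀ G (P Q : ℕ → Set) →
  (∀ v → v < order G → P v ⊎ Q v) → (∀ v → ¬ (P v × Q v)) →
  (∀ u v → IsEdge G u v → (P u × Q v) ⊎ (Q u × P v)) → Bipartite G
bipartite-by-classes G P Q cover disjoint crossing = colour , proper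
  where
  colour : ℕ → Bool
  colour v with v <? order G
  ... | no _ = true
  ... | yes v<n with cover v v<n
  ...   | inj₁ _ = true
  ...   | inj₂ _ = false

  colour-P : ∀ {v} → P v → colour v ≡ true
  colour-P {v} pv with v <? order G
  ... | no _ = refl
  ... | yes v<n with cover v v<n
  ...   | inj₁ _ = refl
  ...   | inj₂ qv = ⊥-elim (disjoint v (pv , qv))

  colour-Q : ∀ {v} → v < order G → Q v → colour v ≡ false
  colour-Q {v} v<n qv with v <? order G
  ... | no v≮n = ⊥-elim (v≮n v<n)
  ... | yes v<n′ with cover v v<n′
  ...   | inj₁ pv = ⊥-elim (disjoint v (pv , qv))
  ...   | inj₂ _ = refl

  true≢false : true ≢ false
  true≢false ()

  proper : ∀ u v → IsEdge G u v → colour u ≢ colour v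
  proper u v e@(u<n , v<n , _) with crossing u v e
  ... | inj₁ (pu , qv) = λ eq → true≢false (trans (sym (colour-P pu)) (trans eq (colour-Q v<n qv)))
  ... | inj₂ (qu , pv) = λ eq → true≢false (trans (sym (colour-P pv)) (trans (sym eq) (colour-Q u<n qu)))

+<⇒<∸ : ∀ i {j n} → i + j < n → j < n ∸ i
+<⇒<∸ zero i+j<n = i+j<n
+<⇒<∸ (suc i) {n = suc n} (s≤s i+j<n) = +<⇒<∸ i i+j<n

<∸⇒+< : ∀ i {j n} → j < n ∸ i → i + j < n
<∸⇒+< zero j<n = j<n
<∸⇒+< (suc i) {n = suc n} j<n∸i = s≤s (<∸⇒+< i j<n∸i)

-- The list of the values g i j over the triangle i + j < n, row by row.
-- Both U_k^(1) and U_k^(2) are lists of this shape.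
triangle-list : {A : Set} → ℕ → (ℕ → ℕ → A) → List A
triangle-list n g = concatMap (λ i → map (g i) (upTo (n ∸ i))) (upTo n)

∈-row : ∀ {A : Set} {g : ℕ → ℕ → A} {n i x} →
        x ∈ map (g i) (upTo (n ∸ i)) → ∃ λ j → i + j < n × x ≡ g i j
∈-row {g = g} {i = i} x∈ with ∈-map⁻ (g i) x∈
... | j , j∈ , refl = j , <∸⇒+< i (∈-upTo⁻ j∈) , refl

∈-triangle⁻ : ∀ {A : Set} {g : ℕ → ℕ → A} {n x} →
              x ∈ triangle-list n g → ∃ λ i → ∃ λ j → i + j < n × x ≡ g i j
∈-triangle⁻ {g = g} {n} x∈ with ∈-concat⁻′ (map (λ i → map (g i) (upTo (n ∸ i))) (upTo n)) x∈
... | _ , x∈row , row∈ with ∈-map⁻ (λ i → map (g i) (upTo (n ∸ i))) row∈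
...   | i , _ , refl = i , ∈-row {g = g} x∈row

∈-triangle⁺ : ∀ {A : Set} {g : ℕ → ℕ → A} {n i j} → i + j < n → g i j ∈ triangle-list n g
∈-triangle⁺ {g = g} {n} {i} {j} i+j<n =
  ∈-concat⁺′ (∈-map⁺ (g i) (∈-upTo⁺ (+<⇒<∸ i i+j<n)))
             (∈-map⁺ (λ i → map (g i) (upTo (n ∸ i))) (∈-upTo⁺ (≤-<-trans (m≤m+n i j) i+j<n)))

allPairs-triangle : ∀ {A : Set} (R : A → A → Set) n (g : ℕ → ℕ → A) →
  (∀ {i j i′ j′} → i + j < n → i′ + j′ < n → R (g i j) (g i′ j′) → i ≡ i′ × j ≡ j′) →
  AllPairs (λ x y → ¬ R x y) (triangle-list n g)
allPairs-triangle R n g injective =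
  AllPairs.concat⁺ (AllProps.map⁺ (All.tabulate λ {i} _ → within-row i))
                   (AllPairs.map⁺ (AllPairs.applyUpTo⁺₁ id n across-rows))
  where
  row : ℕ → List _
  row i = map (g i) (upTo (n ∸ i))

  within-row : ∀ i → AllPairs (λ x y → ¬ R x y) (row i)
  within-row i = AllPairs.map⁺ (AllPairs.applyUpTo⁺₁ id (n ∸ i) λ j<j′ j′<n∸i r →
    <-irrefl (proj₂ (injective (<∸⇒+< i (<-trans j<j′ j′<n∸i)) (<∸⇒+< i j′<n∸i) r)) j<j′)

  different-rows : ∀ {i i′ x y} → i ≢ i′ → x ∈ row i → y ∈ row i′ → ¬ R x y
  different-rows i≢i′ x∈ y∈ r with ∈-row {g = g} x∈ | ∈-row {g = g} y∈
  ... | _ , i+j<n , refl | _ , i′+j′<n , refl = i≢i′ (proj₁ (injective i+j<n i′+j′<n r))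

  across-rows : ∀ {i i′} → i < i′ → i′ < n → All (λ x → All (λ y → ¬ R x y) (row i′)) (row i)
  across-rows i<i′ _ = All.tabulate λ x∈ → All.tabulate λ y∈ → different-rows (<⇒≢ i<i′) x∈ y∈

triangle : ℕ → ℕ
triangle zero = 0
triangle (suc n) = suc n + triangle n

-- Rows of lengths n, n - 1, …, 1 (indexed through h, so that the induction
-- can shift the row indices).
length-rows : ∀ {A : Set} n (h : ℕ → ℕ) (row : ℕ → List A) →
  (∀ i → i < n → length (row (h i)) ≡ n ∸ i) →
  length (concatMap row (applyUpTo h n)) ≡ triangle n
length-rows zero h row lengths = refl
length-rows (suc n) h row lengths = trans (length-++ (row (h 0)))
  (cong₂ _+_ (lengths 0 (s≤s z≤n))
             (length-rows n (λ i → h (suc i)) row (λ i i<n → lengths (suc i) (s≤s i<n))))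

length-triangle : ∀ {A : Set} n (g : ℕ → ℕ → A) → length (triangle-list n g) ≡ triangle n
length-triangle n g = length-rows n id (λ i → map (g i) (upTo (n ∸ i)))
  (λ i _ → trans (length-map (g i) (upTo (n ∸ i))) (length-applyUpTo id (n ∸ i)))

triangle-consecutive : ∀ s → triangle (suc s) + triangle s ≡ suc s * suc s
triangle-consecutive zero = refl
triangle-consecutive (suc s) = begin
  (suc (suc s) + triangle (suc s)) + (suc s + triangle s)  ≡⟨ interchange (suc (suc s)) (suc s) _ _ ⟩
  suc (suc s) + suc s + (triangle (suc s) + triangle s)    ≡⟨ cong (suc (suc s) + suc s +_) (triangle-consecutive s) ⟩
  suc (suc s) + suc s + suc s * suc s                      ≡⟨ square (suc s) ⟩
  suc (suc s) * suc (suc s)                                ∎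
  where
  open ≡-Reasoning
  interchange : ∀ a b x y → (a + x) + (b + y) ≡ a + b + (x + y)
  interchange = solve-∀
  square : ∀ n → suc n + n + n * n ≡ suc n * suc n
  square = solve-∀

triangle-double : ∀ n → triangle n + triangle n ≡ n * suc n
triangle-double zero = refl
triangle-double (suc n) = begin
  (suc n + triangle n) + (suc n + triangle n)  ≡⟨ interchange (suc n) (suc n) _ _ ⟩
  suc n + suc n + (triangle n + triangle n)    ≡⟨ cong (suc n + suc n +_) (triangle-double n) ⟩
  suc n + suc n + n * suc n                    ≡⟨ rectangle n ⟩
  suc n * suc (suc n)                          ∎
  where
  open ≡-Reasoning
  interchange : ∀ a b x y → (a + x) + (b + y) ≡ a + b + (x + y)
  interchange = solve-∀
  rectangle : ∀ n → suc n + suc n + n * suc n ≡ suc n * suc (suc n)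
  rectangle = solve-∀

parity : ∀ t → (∃ λ s → t ≡ s * 2) ⊎ (∃ λ s → t ≡ 1 + s * 2)
parity zero = inj₁ (0 , refl)
parity (suc t) with parity t
... | inj₁ (s , t≡2s) = inj₂ (s , cong suc t≡2s)
... | inj₂ (s , t≡2s+1) = inj₁ (suc s , cong suc t≡2s+1)

halves : ∀ t → (∃ λ s → t ≡ s * 2 × suc (suc t) / 2 ≡ suc s × suc t / 2 ≡ s)
             ⊎ (∃ λ s → t ≡ 1 + s * 2 × suc (suc t) / 2 ≡ suc s × suc t / 2 ≡ suc s)
halves t with parity t
... | inj₁ (s , refl) = inj₁ (s , refl , [r+qn]/n≡q (suc s) 0 2 0<2 , [r+qn]/n≡q s 1 2 1<2)
... | inj₂ (s , refl) = inj₂ (s , refl , [r+qn]/n≡q (suc s) 1 2 1<2 , [r+qn]/n≡q (suc s) 0 2 0<2)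

module Construction (t : ℕ) where

  k : ℕ
  k = suc (suc t)

  m : ℕ
  m = k / 2

  m₂ : ℕ
  m₂ = suc t / 2

  G : Graph
  G = And k

  m+m₂≡1+t : m + m₂ ≡ suc t
  m+m₂≡1+t with halves t
  ... | inj₁ (s , t≡2s , m≡1+s , m₂≡s) = begin
    m + m₂            ≡⟨ cong₂ _+_ m≡1+s m₂≡s ⟩
    suc s + s         ≡⟨ even-sum s ⟩
    suc (s * 2)       ≡⟨ cong suc t≡2s ⟨
    suc t             ∎
    where
    open ≡-Reasoning
    even-sum : ∀ s → suc s + s ≡ suc (s * 2)
    even-sum = solve-∀
  ... | inj₂ (s , t≡2s+1 , m≡1+s , m₂≡1+s) = begin
    m + m₂            ≡⟨ cong₂ _+_ m≡1+s m₂≡1+s ⟩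
    suc s + suc s     ≡⟨ odd-sum s ⟩
    suc (1 + s * 2)   ≡⟨ cong suc t≡2s+1 ⟨
    suc t             ∎
    where
    open ≡-Reasoning
    odd-sum : ∀ s → suc s + suc s ≡ suc (1 + s * 2)
    odd-sum = solve-∀

  m₂≤t : m₂ ≤ t
  m₂≤t = s≤s⁻¹ (m/n<m (suc t) 2 (s≤s (s≤s z≤n)))

  m₂<k : m₂ < k
  m₂<k = s≤s (m≤n⇒m≤1+n m₂≤t)

  <m⇒≤t : ∀ {j} → j < m → j ≤ t
  <m⇒≤t j<m = s≤s⁻¹ (≤-trans j<m (subst (m ≤_) m+m₂≡1+t (m≤m+n m m₂)))

  <m⇒m₂≤t∸ : ∀ {j} → j < m → m₂ ≤ t ∸ j
  <m⇒m₂≤t∸ {j} j<m = m+n≤o⇒m≤o∸n m₂ (s≤s⁻¹ (begin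
    suc (m₂ + j)   ≡⟨ +-suc m₂ j ⟨
    m₂ + suc j     ≤⟨ +-monoʳ-≤ m₂ j<m ⟩
    m₂ + m         ≡⟨ +-comm m₂ m ⟩
    m + m₂         ≡⟨ m+m₂≡1+t ⟩
    suc t          ∎))
    where open ≤-Reasoning

  m₂≤⇒t∸<m : ∀ {b} → b ≤ t → m₂ ≤ b → t ∸ b < m
  m₂≤⇒t∸<m {b} b≤t m₂≤b = +-cancelʳ-< m₂ (t ∸ b) m (begin-strict
    t ∸ b + m₂     ≤⟨ +-monoʳ-≤ (t ∸ b) m₂≤b ⟩
    t ∸ b + b      ≡⟨ m∸n+n≡m b≤t ⟩
    t              <⟨ n<1+n t ⟩
    suc t          ≡⟨ m+m₂≡1+t ⟨
    m + m₂         ∎)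
    where open ≤-Reasoning

  u2-entry : ℕ → ℕ → ℕ × ℕ
  u2-entry i j = (3 * i , (3 * i + 1) + 3 * j)

  u2-entry-form : ∀ i j → (3 * i + 1) + 3 * j ≡ 3 * (i + j) + 1
  u2-entry-form = solve-∀

  u1-entry : ℕ → ℕ → ℕ × ℕ
  u1-entry i j = ((3 * k ∸ 4) ∸ 3 * i , (3 * k ∸ 5) ∸ 3 * (i + j))

  U1≡triangle : U1 k ≡ triangle-list m u1-entry
  U1≡triangle = cong concat (map-cong (λ i → sym (map-∘ (upTo (m ∸ i)))) (upTo m))

  3t+r∸3i : ∀ {i} r → i ≤ t → (3 * t + r) ∸ 3 * i ≡ 3 * (t ∸ i) + r
  3t+r∸3i {i} r i≤t = begin
    (3 * t + r) ∸ 3 * i                  ≡⟨ cong (λ x → (3 * x + r) ∸ 3 * i) (m+[n∸m]≡n i≤t) ⟨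
    (3 * (i + (t ∸ i)) + r) ∸ 3 * i      ≡⟨ cong (_∸ 3 * i) (distribute i (t ∸ i) r) ⟩
    (3 * i + (3 * (t ∸ i) + r)) ∸ 3 * i  ≡⟨ m+n∸m≡n (3 * i) _ ⟩
    3 * (t ∸ i) + r                      ∎
    where
    open ≡-Reasoning
    distribute : ∀ i c r → 3 * (i + c) + r ≡ 3 * i + (3 * c + r)
    distribute = solve-∀

  u1-entry-form : ∀ i j → i + j < m → u1-entry i j ≡ (3 * (t ∸ i) + 2 , 3 * (t ∸ (i + j)) + 1)
  u1-entry-form i j i+j<m = cong₂ _,_
    (trans (cong (_∸ 3 * i) (cong (_∸ 4) (3k≡4+[3t+2] t))) (3t+r∸3i 2 (m+n≤o⇒m≤o i (<m⇒≤t i+j<m))))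
    (trans (cong (_∸ 3 * (i + j)) (cong (_∸ 5) (3k≡5+[3t+1] t))) (3t+r∸3i 1 (<m⇒≤t i+j<m)))
    where
    3k≡4+[3t+2] : ∀ t → 3 * suc (suc t) ≡ 4 + (3 * t + 2)
    3k≡4+[3t+2] = solve-∀
    3k≡5+[3t+1] : ∀ t → 3 * suc (suc t) ≡ 5 + (3 * t + 1)
    3k≡5+[3t+1] = solve-∀

  EdgeInA : ℕ → ℕ → Set
  EdgeInA u v = ∃ λ a → ∃ λ b → a ≤ b × b < m₂ × u ≡ 3 * a × v ≡ 3 * b + 1

  EdgeInB : ℕ → ℕ → Set
  EdgeInB u v = ∃ λ a → ∃ λ b → m₂ ≤ b × b ≤ a × a ≤ t × u ≡ 3 * a + 2 × v ≡ 3 * b + 1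

  ∈U2⁻ : ∀ {u v} → (u , v) ∈ U2 k → EdgeInA u v
  ∈U2⁻ uv∈ with ∈-triangle⁻ {g = u2-entry} {n = m₂} uv∈
  ... | i , j , i+j<m₂ , refl = i , i + j , m≤m+n i j , i+j<m₂ , refl , u2-entry-form i j

  ∈U2⁺ : ∀ {u v} → EdgeInA u v → (u , v) ∈ U2 k
  ∈U2⁺ (a , b , a≤b , b<m₂ , refl , refl) =
    subst (λ p → p ∈ U2 k) (cong (3 * a ,_) second)
      (∈-triangle⁺ {g = u2-entry} {n = m₂} {i = a} {j = b ∸ a} (subst (_< m₂) (sym (m+[n∸m]≡n a≤b)) b<m₂))
    where
    second : (3 * a + 1) + 3 * (b ∸ a) ≡ 3 * b + 1
    second = trans (u2-entry-form a (b ∸ a)) (cong (λ x → 3 * x + 1) (m+[n∸m]≡n a≤b))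

  ∈U1⁻ : ∀ {u v} → (u , v) ∈ U1 k → EdgeInB u v
  ∈U1⁻ {u} {v} uv∈ with ∈-triangle⁻ {g = u1-entry} (subst ((u , v) ∈_) U1≡triangle uv∈)
  ... | i , j , i+j<m , uv≡ =
    t ∸ i , t ∸ (i + j) , <m⇒m₂≤t∸ {i + j} i+j<m , ∸-monoʳ-≤ t (m≤m+n i j) , m∸n≤m t i ,
    cong proj₁ (trans uv≡ (u1-entry-form i j i+j<m)) , cong proj₂ (trans uv≡ (u1-entry-form i j i+j<m))

  ∈U1⁺ : ∀ {u v} → EdgeInB u v → (u , v) ∈ U1 k
  ∈U1⁺ (a , b , m₂≤b , b≤a , a≤t , refl , refl) =
    subst (λ p → p ∈ U1 k) entry≡ (subst (u1-entry i j ∈_) (sym U1≡triangle) (∈-triangle⁺ {g = u1-entry} {i = i} {j = j} i+j<m))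
    where
    b≤t : b ≤ t
    b≤t = ≤-trans b≤a a≤t
    i : ℕ
    i = t ∸ a
    j : ℕ
    j = (t ∸ b) ∸ (t ∸ a)
    i+j≡t∸b : i + j ≡ t ∸ b
    i+j≡t∸b = m+[n∸m]≡n (∸-monoʳ-≤ t b≤a)
    i+j<m : i + j < m
    i+j<m = subst (_< m) (sym i+j≡t∸b) (m₂≤⇒t∸<m b≤t m₂≤b)
    entry≡ : u1-entry i j ≡ (3 * a + 2 , 3 * b + 1)
    entry≡ = trans (u1-entry-form i j i+j<m) (cong₂ _,_
      (cong (λ x → 3 * x + 2) (m∸[m∸n]≡n a≤t))
      (trans (cong (λ x → 3 * (t ∸ x) + 1) i+j≡t∸b) (cong (λ x → 3 * x + 1) (m∸[m∸n]≡n b≤t))))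

  Listed : ℕ → ℕ → Set
  Listed u v = EdgeInA u v ⊎ EdgeInB u v

  ∈Flist⁻ : ∀ {u v} → (u , v) ∈ Flist k → Listed u v
  ∈Flist⁻ uv∈ with ∈-++⁻ (U1 k) uv∈
  ... | inj₁ ∈U1 = inj₂ (∈U1⁻ ∈U1)
  ... | inj₂ ∈U2 = inj₁ (∈U2⁻ ∈U2)

  Listed⇒F : ∀ {u v} → Listed u v → F k u v
  Listed⇒F (inj₁ inA) = inj₁ (∈-++⁺ʳ (U1 k) (∈U2⁺ inA))
  Listed⇒F (inj₂ inB) = inj₁ (∈-++⁺ˡ (∈U1⁺ inB))

  F⇒Listed : ∀ {u v} → F k u v → Listed u v ⊎ Listed v u
  F⇒Listed (inj₁ uv∈) = inj₁ (∈Flist⁻ uv∈)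
  F⇒Listed (inj₂ vu∈) = inj₂ (∈Flist⁻ vu∈)

  F-sym : ∀ {u v} → F k u v → F k v u
  F-sym (inj₁ uv∈) = inj₂ uv∈
  F-sym (inj₂ vu∈) = inj₁ vu∈

  3k≡1+[3t+5] : 3 * k ≡ suc (3 * t + 5)
  3k≡1+[3t+5] = 3[2+t] t
    where
    3[2+t] : ∀ t → 3 * suc (suc t) ≡ suc (3 * t + 5)
    3[2+t] = solve-∀

  order≡ : order G ≡ 3 * t + 5
  order≡ = cong (_∸ 1) 3k≡1+[3t+5]

  below-order : ∀ {v} → v ≤ 3 * t + 4 → v < order G
  below-order {v} v≤3t+4 = subst (v <_) (sym (trans order≡ (+-suc (3 * t) 4))) (s≤s v≤3t+4)

  3i+1<order : ∀ {i} → i ≤ suc t → 3 * i + 1 < order G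
  3i+1<order i≤1+t = below-order (≤-trans (+-monoˡ-≤ 1 (*-monoʳ-≤ 3 i≤1+t)) (≤-reflexive (3[1+t]+1 t)))
    where
    3[1+t]+1 : ∀ t → 3 * suc t + 1 ≡ 3 * t + 4
    3[1+t]+1 = solve-∀

  <order⇒<3t+5 : ∀ {v} → v < order G → v < 3 * t + 5
  <order⇒<3t+5 {v} = subst (v <_) order≡

  3q<3t+5⇒q<k : ∀ {q} → 3 * q < 3 * t + 5 → q < k
  3q<3t+5⇒q<k {q} 3q<3t+5 = *-cancelˡ-< 3 q k (<-trans 3q<3t+5 (≤-reflexive (sym 3k≡1+[3t+5])))

  AB⊆V : ∀ v → A k v ⊎ B k v → v < order G
  AB⊆V _ (inj₁ (inj₁ (i , i<k , refl))) =
    ≤-<-trans (m≤m+n (3 * i) 1) (3i+1<order (s≤s⁻¹ i<k))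
  AB⊆V _ (inj₁ (inj₂ (i , i<m₂ , refl))) = 3i+1<order (≤-trans (<⇒≤ i<m₂) (m≤n⇒m≤1+n m₂≤t))
  AB⊆V _ (inj₂ (inj₁ (i , i≤t , refl))) =
    below-order (≤-trans (+-monoˡ-≤ 2 (*-monoʳ-≤ 3 i≤t)) (+-monoʳ-≤ (3 * t) (s≤s (s≤s z≤n))))
  AB⊆V _ (inj₂ (inj₂ (i , _ , i≤1+t , refl))) = 3i+1<order i≤1+t

  V⊆AB : ∀ v → v < order G → A k v ⊎ B k v
  V⊆AB v v<n with mod3-view v
  ... | ≡0 q = inj₁ (inj₁ (q , 3q<3t+5⇒q<k (<order⇒<3t+5 v<n) , refl))
  ... | ≡1 q with q <? m₂
  ...   | yes q<m₂ = inj₁ (inj₂ (q , q<m₂ , refl))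
  ...   | no q≮m₂ = inj₂ (inj₂ (q , ≮⇒≥ q≮m₂ , s≤s⁻¹ q<k , refl))
    where
    q<k : q < k
    q<k = 3q<3t+5⇒q<k (≤-<-trans (m≤m+n (3 * q) 1) (<order⇒<3t+5 v<n))
  V⊆AB v v<n | ≡2 q = inj₂ (inj₁ (q , s≤s⁻¹ q<1+t , refl))
    where
    3q+2<3[1+t]+2 : 3 * q + 2 < 3 * suc t + 2
    3q+2<3[1+t]+2 = subst (3 * q + 2 <_) (3t+5≡3[1+t]+2 t) (<order⇒<3t+5 v<n)
      where
      3t+5≡3[1+t]+2 : ∀ t → 3 * t + 5 ≡ 3 * suc t + 2
      3t+5≡3[1+t]+2 = solve-∀
    q<1+t : q < suc t
    q<1+t = *-cancelˡ-< 3 q (suc t) (+-cancelʳ-< 2 (3 * q) (3 * suc t) 3q+2<3[1+t]+2)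

  A∩B : ∀ v → ¬ (A k v × B k v)
  A∩B _ (inj₁ (i , _ , v≡) , inj₁ (j , _ , v≡′)) = ≢-mod3 i j 0<3 2<3 (trans v≡ (3a≡3a+0 i)) v≡′ (inj₁ (λ ())) refl
  A∩B _ (inj₁ (i , _ , v≡) , inj₂ (j , _ , _ , v≡′)) = ≢-mod3 i j 0<3 1<3 (trans v≡ (3a≡3a+0 i)) v≡′ (inj₁ (λ ())) refl
  A∩B _ (inj₂ (i , _ , v≡) , inj₁ (j , _ , v≡′)) = ≢-mod3 i j 1<3 2<3 v≡ v≡′ (inj₁ (λ ())) refl
  A∩B _ (inj₂ (i , i<m₂ , v≡) , inj₂ (j , m₂≤j , _ , v≡′)) =
    <⇒≱ i<m₂ (subst (m₂ ≤_) (sym i≡j) m₂≤j)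
    where
    i≡j : i ≡ j
    i≡j = proj₁ (3a+r-injective 1<3 1<3 (trans (sym v≡) v≡′))

  EdgeInA⇒A : ∀ {u v} → EdgeInA u v → A k u × A k v
  EdgeInA⇒A (a , b , a≤b , b<m₂ , refl , refl) =
    inj₁ (a , ≤-<-trans a≤b (<-trans b<m₂ m₂<k) , refl) , inj₂ (b , b<m₂ , refl)

  EdgeInB⇒B : ∀ {u v} → EdgeInB u v → B k u × B k v
  EdgeInB⇒B (a , b , m₂≤b , b≤a , a≤t , refl , refl) =
    inj₁ (a , a≤t , refl) , inj₂ (b , m₂≤b , m≤n⇒m≤1+n (≤-trans b≤a a≤t) , refl)

  F⇒same-class : ∀ {u v} → F k u v → (A k u × A k v) ⊎ (B k u × B k v)
  F⇒same-class f with F⇒Listed f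
  ... | inj₁ (inj₁ inA) = inj₁ (EdgeInA⇒A inA)
  ... | inj₁ (inj₂ inB) = inj₂ (EdgeInB⇒B inB)
  ... | inj₂ (inj₁ inA) = let (Av , Au) = EdgeInA⇒A inA in inj₁ (Au , Av)
  ... | inj₂ (inj₂ inB) = let (Bv , Bu) = EdgeInB⇒B inB in inj₂ (Bu , Bv)

  Listed⇒edge : ∀ {u v} → Listed u v → IsEdge G u v
  Listed⇒edge {u} {v} (inj₁ inA@(_ , _ , a≤b , _ , refl , refl)) =
    AB⊆V u (inj₁ (proj₁ (EdgeInA⇒A inA))) , AB⊆V v (inj₁ (proj₂ (EdgeInA⇒A inA))) , ~-0-1 a≤b
  Listed⇒edge {u} {v} (inj₂ inB@(_ , _ , _ , b≤a , _ , refl , refl)) =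
    AB⊆V u (inj₂ (proj₁ (EdgeInB⇒B inB))) , AB⊆V v (inj₂ (proj₂ (EdgeInB⇒B inB))) , ~-2-1 b≤a

  F⊆E : F k ⊆E G
  F⊆E u v f with F⇒Listed f
  ... | inj₁ uv = Listed⇒edge uv
  ... | inj₂ vu = let (v<n , u<n , v~u) = Listed⇒edge vu in u<n , v<n , ~-sym v u v~u

  A-edge⇒F : ∀ {u v} → A k u → A k v → u ~ v → F k u v
  A-edge⇒F (inj₁ (i , _ , refl)) (inj₁ (j , _ , refl)) adj = ⊥-elim (≁-0-0 i j adj)
  A-edge⇒F (inj₁ (i , _ , refl)) (inj₂ (j , j<m₂ , refl)) adj with i ≤? j
  ... | yes i≤j = Listed⇒F (inj₁ (i , j , i≤j , j<m₂ , refl , refl))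
  ... | no i≰j = ⊥-elim (≁-0-1 (≰⇒> i≰j) adj)
  A-edge⇒F (inj₂ (i , i<m₂ , refl)) (inj₁ (j , _ , refl)) adj with j ≤? i
  ... | yes j≤i = F-sym (Listed⇒F (inj₁ (j , i , j≤i , i<m₂ , refl , refl)))
  ... | no j≰i = ⊥-elim (≁-0-1 (≰⇒> j≰i) (~-sym (3 * i + 1) (3 * j) adj))
  A-edge⇒F (inj₂ (i , _ , refl)) (inj₂ (j , _ , refl)) adj = ⊥-elim (≁-same i j 1 adj)

  B-edge⇒F : ∀ {u v} → B k u → B k v → u ~ v → F k u v
  B-edge⇒F (inj₁ (i , _ , refl)) (inj₁ (j , _ , refl)) adj = ⊥-elim (≁-same i j 2 adj)
  B-edge⇒F (inj₁ (i , i≤t , refl)) (inj₂ (j , m₂≤j , _ , refl)) adj with j ≤? i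
  ... | yes j≤i = Listed⇒F (inj₂ (i , j , m₂≤j , j≤i , i≤t , refl , refl))
  ... | no j≰i = ⊥-elim (≁-2-1 (≰⇒> j≰i) adj)
  B-edge⇒F (inj₂ (i , m₂≤i , _ , refl)) (inj₁ (j , j≤t , refl)) adj with i ≤? j
  ... | yes i≤j = F-sym (Listed⇒F (inj₂ (j , i , m₂≤i , i≤j , j≤t , refl , refl)))
  ... | no i≰j = ⊥-elim (≁-2-1 (≰⇒> i≰j) (~-sym (3 * i + 1) (3 * j + 2) adj))
  B-edge⇒F (inj₂ (i , _ , _ , refl)) (inj₂ (j , _ , _ , refl)) adj = ⊥-elim (≁-same i j 1 adj)

  Crossing : ℕ → ℕ → Set
  Crossing u v = (A k u × B k v) ⊎ (B k u × A k v)

  crossing⇒¬F : ∀ {u v} → Crossing u v → ¬ F k u v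
  crossing⇒¬F {u} {v} uv f with uv | F⇒same-class f
  ... | inj₁ (Au , Bv) | inj₁ (_ , Av) = A∩B v (Av , Bv)
  ... | inj₁ (Au , Bv) | inj₂ (Bu , _) = A∩B u (Au , Bu)
  ... | inj₂ (Bu , Av) | inj₁ (Au , _) = A∩B u (Au , Bu)
  ... | inj₂ (Bu , Av) | inj₂ (_ , Bv) = A∩B v (Av , Bv)

  edges-cross : ∀ u v → IsEdge (G ─ F k) u v → Crossing u v
  edges-cross u v (u<n , v<n , adj , ¬f) with V⊆AB u u<n | V⊆AB v v<n
  ... | inj₁ Au | inj₁ Av = ⊥-elim (¬f (A-edge⇒F Au Av adj))
  ... | inj₁ Au | inj₂ Bv = inj₁ (Au , Bv)
  ... | inj₂ Bu | inj₁ Av = inj₂ (Bu , Av)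
  ... | inj₂ Bu | inj₂ Bv = ⊥-elim (¬f (B-edge⇒F Bu Bv adj))

  bipartite : Bipartite (G ─ F k)
  bipartite = bipartite-by-classes (G ─ F k) (A k) (B k) V⊆AB A∩B edges-cross

  restored-edge : ∀ {u v} e → Listed u v → SameEdge (u , v) e → IsEdge (G ─ (F k ∖₁ e)) u v
  restored-edge e uv same = let (u<n , v<n , adj) = Listed⇒edge uv in
    u<n , v<n , adj , λ (_ , ¬same) → ¬same same

  crossing-edge : ∀ {x y} e → Crossing x y → x ~ y → IsEdge (G ─ (F k ∖₁ e)) x y
  crossing-edge {x} {y} e xy adj = AB⊆V x x∈AB , AB⊆V y y∈AB , adj , λ (f , _) → crossing⇒¬F xy f
    where
    x∈AB : A k x ⊎ B k x
    x∈AB = Sum.map proj₁ proj₁ xy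
    y∈AB : A k y ⊎ B k y
    y∈AB = Sum.swap (Sum.map proj₂ proj₂ xy)

  -- Restoring the edge v_{3a} v_{3b+1} inside A_k closes the 5-cycle
  -- v_{3a} v_{3b+1} v_{3b+2} v_{3b+3} v_{3m₂+1}.
  C5-through-A : ∀ {u v} e → EdgeInA u v → SameEdge (u , v) e → HasC5 (G ─ (F k ∖₁ e))
  C5-through-A e inA@(a , b , a≤b , b<m₂ , refl , refl) same =
    3 * a , 3 * b + 1 , 3 * b + 2 , 3 * suc b , 3 * m₂ + 1 ,
    distinct ,
    restored-edge e (inj₁ inA) same ,
    crossing-edge e (inj₁ (A₁ , B₂)) (~-sym (3 * b + 2) (3 * b + 1) (~-2-1 {b} ≤-refl)) ,
    crossing-edge e (inj₂ (B₂ , A₃)) (~-sym (3 * suc b) (3 * b + 2) (~-0-2 (n<1+n b))) ,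
    crossing-edge e (inj₁ (A₃ , B₄)) (~-0-1 b<m₂) ,
    crossing-edge e (inj₂ (B₄ , A₀)) (~-sym (3 * a) (3 * m₂ + 1) (~-0-1 (≤-trans a≤b (<⇒≤ b<m₂))))
    where
    A₀ : A k (3 * a)
    A₀ = inj₁ (a , ≤-<-trans a≤b (<-trans b<m₂ m₂<k) , refl)
    A₁ : A k (3 * b + 1)
    A₁ = inj₂ (b , b<m₂ , refl)
    B₂ : B k (3 * b + 2)
    B₂ = inj₁ (b , ≤-trans (<⇒≤ b<m₂) m₂≤t , refl)
    A₃ : A k (3 * suc b)
    A₃ = inj₁ (suc b , ≤-<-trans b<m₂ m₂<k , refl)
    B₄ : B k (3 * m₂ + 1)
    B₄ = inj₂ (m₂ , ≤-refl , m≤n⇒m≤1+n m₂≤t , refl)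
    distinct : AllPairs _≢_ (3 * a ∷ 3 * b + 1 ∷ 3 * b + 2 ∷ 3 * suc b ∷ 3 * m₂ + 1 ∷ [])
    distinct =
      (≢-mod3 a b 0<3 1<3 (3a≡3a+0 a) refl (inj₁ (λ ())) ∷
       ≢-mod3 a b 0<3 2<3 (3a≡3a+0 a) refl (inj₁ (λ ())) ∷
       ≢-mod3 a (suc b) 0<3 0<3 (3a≡3a+0 a) (3a≡3a+0 (suc b)) (inj₂ (λ a≡1+b → 1+n≰n (subst (_≤ b) a≡1+b a≤b))) ∷
       ≢-mod3 a m₂ 0<3 1<3 (3a≡3a+0 a) refl (inj₁ (λ ())) ∷ []) ∷
      (≢-mod3 b b 1<3 2<3 refl refl (inj₁ (λ ())) ∷
       ≢-mod3 b (suc b) 1<3 0<3 refl (3a≡3a+0 (suc b)) (inj₁ (λ ())) ∷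
       ≢-mod3 b m₂ 1<3 1<3 refl refl (inj₂ (<⇒≢ b<m₂)) ∷ []) ∷
      (≢-mod3 b (suc b) 2<3 0<3 refl (3a≡3a+0 (suc b)) (inj₁ (λ ())) ∷
       ≢-mod3 b m₂ 2<3 1<3 refl refl (inj₁ (λ ())) ∷ []) ∷
      (≢-mod3 (suc b) m₂ 0<3 1<3 (3a≡3a+0 (suc b)) refl (inj₁ (λ ())) ∷ []) ∷
      [] ∷ []

  -- Restoring the edge v_{3a+2} v_{3b+1} inside B_k closes the 5-cycle
  -- v_{3a+2} v_{3b+1} v_0 v_{3a+4} v_{3a+3}.
  C5-through-B : ∀ {u v} e → EdgeInB u v → SameEdge (u , v) e → HasC5 (G ─ (F k ∖₁ e))
  C5-through-B e inB@(a , b , m₂≤b , b≤a , a≤t , refl , refl) same =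
    3 * a + 2 , 3 * b + 1 , 0 , 3 * suc a + 1 , 3 * suc a ,
    distinct ,
    restored-edge e (inj₂ inB) same ,
    crossing-edge e (inj₂ (B₁ , A₂)) (~-sym 0 (3 * b + 1) (~-0-1 {0} {b} z≤n)) ,
    crossing-edge e (inj₁ (A₂ , B₃)) (~-0-1 {0} {suc a} z≤n) ,
    crossing-edge e (inj₂ (B₃ , A₄)) (~-sym (3 * suc a) (3 * suc a + 1) (~-0-1 {suc a} ≤-refl)) ,
    crossing-edge e (inj₁ (A₄ , B₀)) (~-0-2 (n<1+n a))
    where
    B₀ : B k (3 * a + 2)
    B₀ = inj₁ (a , a≤t , refl)
    B₁ : B k (3 * b + 1)
    B₁ = inj₂ (b , m₂≤b , m≤n⇒m≤1+n (≤-trans b≤a a≤t) , refl)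
    A₂ : A k 0
    A₂ = inj₁ (0 , s≤s z≤n , refl)
    B₃ : B k (3 * suc a + 1)
    B₃ = inj₂ (suc a , m≤n⇒m≤1+n (≤-trans m₂≤b b≤a) , s≤s a≤t , refl)
    A₄ : A k (3 * suc a)
    A₄ = inj₁ (suc a , s≤s (s≤s a≤t) , refl)
    distinct : AllPairs _≢_ (3 * a + 2 ∷ 3 * b + 1 ∷ 0 ∷ 3 * suc a + 1 ∷ 3 * suc a ∷ [])
    distinct =
      (≢-mod3 a b 2<3 1<3 refl refl (inj₁ (λ ())) ∷
       ≢-mod3 a 0 2<3 0<3 refl refl (inj₁ (λ ())) ∷
       ≢-mod3 a (suc a) 2<3 1<3 refl refl (inj₁ (λ ())) ∷
       ≢-mod3 a (suc a) 2<3 0<3 refl (3a≡3a+0 (suc a)) (inj₁ (λ ())) ∷ []) ∷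
      (≢-mod3 b 0 1<3 0<3 refl refl (inj₁ (λ ())) ∷
       ≢-mod3 b (suc a) 1<3 1<3 refl refl (inj₂ (λ b≡1+a → 1+n≰n (subst (_≤ a) b≡1+a b≤a))) ∷
       ≢-mod3 b (suc a) 1<3 0<3 refl (3a≡3a+0 (suc a)) (inj₁ (λ ())) ∷ []) ∷
      ((λ ()) ∷ (λ ()) ∷ []) ∷
      (≢-mod3 (suc a) (suc a) 1<3 0<3 refl (3a≡3a+0 (suc a)) (inj₁ (λ ())) ∷ []) ∷
      [] ∷ []

  C5-after-restoring : ∀ u v → F k u v → HasC5 (G ─ (F k ∖₁ (u , v)))
  C5-after-restoring u v f with F⇒Listed f
  ... | inj₁ (inj₁ inA) = C5-through-A (u , v) inA (inj₁ (refl , refl))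
  ... | inj₁ (inj₂ inB) = C5-through-B (u , v) inB (inj₁ (refl , refl))
  ... | inj₂ (inj₁ inA) = C5-through-A (u , v) inA (inj₂ (refl , refl))
  ... | inj₂ (inj₂ inB) = C5-through-B (u , v) inB (inj₂ (refl , refl))

  minimal : MinimalBipartification G (F k)
  minimal = F⊆E , bipartite , λ u v f → C5⇒¬bipartite _ (C5-after-restoring u v f)

  u2-injective : ∀ {i j i′ j′} → i + j < m₂ → i′ + j′ < m₂ →
                 SameEdge (u2-entry i j) (u2-entry i′ j′) → i ≡ i′ × j ≡ j′
  u2-injective {i} {j} {i′} {j′} _ _ (inj₁ (3i≡3i′ , second≡)) =
    i≡i′ , +-cancelˡ-≡ i j j′ (trans i+j≡i′+j′ (cong (_+ j′) (sym i≡i′)))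
    where
    i≡i′ : i ≡ i′
    i≡i′ = *-cancelˡ-≡ i i′ 3 3i≡3i′
    i+j≡i′+j′ : i + j ≡ i′ + j′
    i+j≡i′+j′ = proj₁ (3a+r-injective 1<3 1<3
      (trans (sym (u2-entry-form i j)) (trans second≡ (u2-entry-form i′ j′))))
  u2-injective {i} {j} {i′} {j′} _ _ (inj₂ (3i≡second′ , _)) =
    ⊥-elim (≢-mod3 i (i′ + j′) 0<3 1<3 (3a≡3a+0 i) (u2-entry-form i′ j′) (inj₁ (λ ())) 3i≡second′)

  u1-injective : ∀ {i j i′ j′} → i + j < m → i′ + j′ < m →
                 SameEdge (u1-entry i j) (u1-entry i′ j′) → i ≡ i′ × j ≡ j′
  u1-injective {i} {j} {i′} {j′} i+j<m i′+j′<m same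
    with subst₂ SameEdge (u1-entry-form i j i+j<m) (u1-entry-form i′ j′ i′+j′<m) same
  ... | inj₁ (first≡ , second≡) =
    i≡i′ , +-cancelˡ-≡ i j j′ (trans i+j≡i′+j′ (cong (_+ j′) (sym i≡i′)))
    where
    i≡i′ : i ≡ i′
    i≡i′ = ∸-cancelˡ-≡ (m+n≤o⇒m≤o i (<m⇒≤t i+j<m)) (m+n≤o⇒m≤o i′ (<m⇒≤t i′+j′<m))
                       (proj₁ (3a+r-injective 2<3 2<3 first≡))
    i+j≡i′+j′ : i + j ≡ i′ + j′
    i+j≡i′+j′ = ∸-cancelˡ-≡ (<m⇒≤t i+j<m) (<m⇒≤t i′+j′<m) (proj₁ (3a+r-injective 1<3 1<3 second≡))
  ... | inj₂ (first≡second′ , _) =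
    ⊥-elim (≢-mod3 (t ∸ i) (t ∸ (i′ + j′)) 2<3 1<3 refl refl (inj₁ (λ ())) first≡second′)

  different-shapes : ∀ {u v u′ v′} → EdgeInB u v → EdgeInA u′ v′ → ¬ SameEdge (u , v) (u′ , v′)
  different-shapes (a , _ , _ , _ , _ , u≡ , _) (c , _ , _ , _ , u′≡ , _) (inj₁ (u≡u′ , _)) =
    ≢-mod3 a c 2<3 0<3 u≡ (trans u′≡ (3a≡3a+0 c)) (inj₁ (λ ())) u≡u′
  different-shapes (a , _ , _ , _ , _ , u≡ , _) (_ , d , _ , _ , _ , v′≡) (inj₂ (u≡v′ , _)) =
    ≢-mod3 a d 2<3 1<3 u≡ v′≡ (inj₁ (λ ())) u≡v′

  no-repeated-edge : AllPairs (λ p q → ¬ SameEdge p q) (Flist k)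
  no-repeated-edge = AllPairs.++⁺
    (subst (AllPairs _) (sym U1≡triangle) (allPairs-triangle SameEdge m u1-entry u1-injective))
    (allPairs-triangle SameEdge m₂ u2-entry u2-injective)
    (All.tabulate λ {(u , v)} uv∈ → All.tabulate λ {(u′ , v′)} u′v′∈ →
      different-shapes (∈U1⁻ uv∈) (∈U2⁻ u′v′∈))

  |F|≡triangles : length (Flist k) ≡ triangle m + triangle m₂
  |F|≡triangles = trans (length-++ (U1 k)) (cong₂ _+_
    (trans (cong length U1≡triangle) (length-triangle m u1-entry))
    (length-triangle m₂ u2-entry))

  |F|≡k²/4 : length (Flist k) ≡ (k * k) / 4
  |F|≡k²/4 with halves t
  ... | inj₁ (s , t≡2s , m≡1+s , m₂≡s) = begin
    length (Flist k)                              ≡⟨ |F|≡triangles ⟩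
    triangle m + triangle m₂                      ≡⟨ cong₂ _+_ (cong triangle m≡1+s) (cong triangle m₂≡s) ⟩
    triangle (suc s) + triangle s                 ≡⟨ triangle-consecutive s ⟩
    suc s * suc s                                 ≡⟨ [r+qn]/n≡q (suc s * suc s) 0 4 (s≤s z≤n) ⟨
    (0 + suc s * suc s * 4) / 4                   ≡⟨ cong (_/ 4) (even-square s) ⟩
    (suc (suc (s * 2)) * suc (suc (s * 2))) / 4   ≡⟨ cong (λ x → (suc (suc x) * suc (suc x)) / 4) t≡2s ⟨
    (k * k) / 4                                   ∎
    where
    open ≡-Reasoning
    even-square : ∀ s → 0 + suc s * suc s * 4 ≡ suc (suc (s * 2)) * suc (suc (s * 2))
    even-square = solve-∀
  ... | inj₂ (s , t≡2s+1 , m≡1+s , m₂≡1+s) = begin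
    length (Flist k)                                      ≡⟨ |F|≡triangles ⟩
    triangle m + triangle m₂                              ≡⟨ cong₂ _+_ (cong triangle m≡1+s) (cong triangle m₂≡1+s) ⟩
    triangle (suc s) + triangle (suc s)                   ≡⟨ triangle-double (suc s) ⟩
    suc s * suc (suc s)                                   ≡⟨ [r+qn]/n≡q (suc s * suc (suc s)) 1 4 (s≤s (s≤s z≤n)) ⟨
    (1 + suc s * suc (suc s) * 4) / 4                     ≡⟨ cong (_/ 4) (odd-square s) ⟩
    (suc (suc (1 + s * 2)) * suc (suc (1 + s * 2))) / 4   ≡⟨ cong (λ x → (suc (suc x) * suc (suc x)) / 4) t≡2s+1 ⟨
    (k * k) / 4                                           ∎
    where
    open ≡-Reasoning
    odd-square : ∀ s → 1 + suc s * suc (suc s) * 4 ≡ suc (suc (1 + s * 2)) * suc (suc (1 + s * 2))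
    odd-square = solve-∀

  -- Since |And_k| + 1 = 3k, also |F_k| = ⌊(|And_k| + 1)²/36⌋.
  |F|≡[n+1]²/36 : length (Flist k) ≡ ((order G + 1) * (order G + 1)) / 36
  |F|≡[n+1]²/36 = begin
    length (Flist k)                          ≡⟨ |F|≡k²/4 ⟩
    (k * k) / 4                               ≡⟨ m*n/o*n≡m/o (k * k) 9 4 ⟨
    (k * k * 9) / 36                          ≡⟨ cong (_/ 36) (nine-squares t) ⟩
    ((3 * t + 5 + 1) * (3 * t + 5 + 1)) / 36  ≡⟨ cong (λ n → ((n + 1) * (n + 1)) / 36) order≡ ⟨
    ((order G + 1) * (order G + 1)) / 36      ∎
    where
    open ≡-Reasoning
    nine-squares : ∀ t → suc (suc t) * suc (suc t) * 9 ≡ (3 * t + 5 + 1) * (3 * t + 5 + 1)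
    nine-squares = solve-∀

theorem2p1 : ∀ (k : ℕ) → 2 ≤ k →
    (MinimalBipartification (And k) (F k) ×
     (∀ a b → F k a b → HasC5 (And k ─ (F k ∖₁ (a , b)))))
    × ((∀ v → v < order (And k) → (A k v ⊎ B k v) × ¬ (A k v × B k v))
       × (∀ v → A k v ⊎ B k v → v < order (And k))
       × (∀ u v → IsEdge (And k ─ F k) u v → (A k u × B k v) ⊎ (B k u × A k v)))
    × (AllPairs (λ p q → ¬ SameEdge p q) (Flist k)
       × length (Flist k) ≡ (k * k) / 4
       × length (Flist k) ≡ ((order (And k) + 1) * (order (And k) + 1)) / 36)
theorem2p1 (suc (suc t)) (s≤s (s≤s z≤n)) =
  (minimal , C5-after-restoring) ,
  ((λ v v<n → V⊆AB v v<n , A∩B v) , AB⊆V , edges-cross) ,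
  (no-repeated-edge , |F|≡k²/4 , |F|≡[n+1]²/36)
  where open Construction t
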